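{- Let ${\cal D}$ be a balanced quadriculated disk and $p$ a plug with $|p|$ unit squares. If $N$ is even and $N\ge|p|$, then there exists an even tiling ${\mathbf t}\in{\cal T}({\cal R}_{ -N,N;p,p})$ with $\operatorname{plug}_0({\mathbf t})={\mathbf p_\circ}$; in particular ${\mathbf t}\approx{\mathbf t}_{\operatorname{vert}}$, where ${\mathbf t}_{\operatorname{vert}}$ is the tiling of ${\cal R}_{ -N,N;p,p}$ by vertical dominoes only.
   Context: A quadriculated disk ${\cal D}\subset\mathbb{R}^2$ is a finite union of unit squares $[a,a+1]\times[b,b+1]$, $(a,b)\in\mathbb{Z}^2$, contractible with contractible interior; squares have color $(-1)^{a+b}$; ${\cal D}$ is balanced if it has equally many squares of each color. A plug is a union $p\subseteq{\cal D}$ of unit squares of ${\cal D}$ with equally many squares of each color (possibly empty); ${\mathbf p_\circ}=\emptyset$. For integers $N_1\ge N_0+2$ and plugs $p,\tilde p$, the cork is ${\cal R}_{N_0,N_1;p,\tilde p}=({\cal D}\times[N_0,N_1])\setminus\operatorname{int}((p\times[N_0,N_0+1])\cup(\tilde p\times[N_1-1,N_1]))$. A (3D) domino is a union of two unit cubes with integer vertices sharing a face; vertical if of the form $[a,a+1]\times[b,b+1]\times[c,c+2]$. A tiling is a set of dominoes with disjoint interiors covering the region; ${\cal T}({\cal R})$ is the set of tilings. For a tiling ${\mathbf t}$ of a cork ${\cal R}_{N_0,N_1;\cdot,\cdot}$ and $N_0<j<N_1$, $\operatorname{plug}_j({\mathbf t})$ is the union of the squares $s$ of ${\cal D}$ such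 that $s\times[j-1,j+1]$ is a domino of ${\mathbf t}$. A tiling of ${\cal R}_{ -N,N;p,p}$ is even if it is invariant under $(x,y,z)\mapsto(x,y,-z)$. A flip removes two dominoes of a tiling whose union is a $2\times2\times1$ box and replaces them by the other pair tiling that box; $\approx$ means joined by finitely many flips. -}

module Defs where

open import Data.Nat as ℕ using (ℕ; _%_)
open import Data.Integer as ℤ using (ℤ; +_; -_; _-_; _+_; ∣_∣)
open import Data.Product using (Σ; _×_; _,_; proj₁; proj₂)
open import Data.Sum using (_⊎_)
open import Data.Empty using (⊥)
open import Data.Fin using (Fin)
open import Data.List using (List; []; _∷_; _++_; length; filter; lookup)
open import Data.List.Membership.Propositional using (_∈_)
open import Data.List.Relation.Unary.Any using (Any)
open import Data.List.Relation.Unary.Unique.Propositional using (Unique)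
open import Data.List.Relation.Binary.Permutation.Propositional using (_↭_)
open import Relation.Binary.Construct.Closure.ReflexiveTransitive using (Star)
open import Relation.Binary.PropositionalEquality using (_≡_; _≢_)
open import Relation.Nullary using (¬_; ¬?)

-- Unit square [a,a+1]×[b,b+1] is represented by (a , b).
Square : Set
Square = ℤ × ℤ

-- Unit cube [x,x+1]×[y,y+1]×[z,z+1] is represented by (x , y , z).
Cube : Set
Cube = ℤ × ℤ × ℤ

black? : (s : Square) → Relation.Nullary.Dec (∣ proj₁ s + proj₂ s ∣ % 2 ≡ 0)
black? s = ∣ proj₁ s + proj₂ s ∣ % 2 ℕ.≟ 0

Balanced : List Square → Set
Balanced S = length (filter black? S) ≡ length (filter (λ s → ¬? (black? s)) S)

Adjacent : Square → Square → Set
Adjacent (a , b) (a' , b') = ∣ a - a' ∣ ℕ.+ ∣ b - b' ∣ ≡ 1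

AdjIn : (Square → Set) → Square → Square → Set
AdjIn P s s' = P s × P s' × Adjacent s s'

-- Quadriculated disk: finite (a duplicate-free list) nonempty union of unit
-- squares, contractible with contractible interior.  Combinatorially:
-- the squares are edge-connected and the complementary squares of ℤ² are
-- edge-connected.
IsQuadDisk : List Square → Set
IsQuadDisk D =
  Unique D
  × Σ Square (λ s → s ∈ D)
  × (∀ s s' → s ∈ D → s' ∈ D → Star (AdjIn (λ u → u ∈ D)) s s')
  × (∀ s s' → ¬ (s ∈ D) → ¬ (s' ∈ D) → Star (AdjIn (λ u → ¬ (u ∈ D))) s s')

IsPlug : List Square → List Square → Set
IsPlug D p = Unique p × (∀ s → s ∈ p → s ∈ D) × Balanced p

Cork : List Square → ℤ → ℤ → List Square → List Square → Cube → Set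
Cork D N₀ N₁ p p̃ (x , y , z) =
  (x , y) ∈ D × N₀ ℤ.≤ z × z ℤ.< N₁
  × ¬ ((x , y) ∈ p × z ≡ N₀)
  × ¬ ((x , y) ∈ p̃ × z ≡ N₁ - + 1)

data Dir : Set where
  dx dy dz : Dir

shift : Dir → Cube → Cube
shift dx (x , y , z) = (x + + 1 , y , z)
shift dy (x , y , z) = (x , y + + 1 , z)
shift dz (x , y , z) = (x , y , z + + 1)

-- Domino = the union of cube `base` and cube `shift dir base`.
record Domino : Set where
  constructor dom
  field
    base : Cube
    dir  : Dir
open Domino public

Covers : Domino → Cube → Set
Covers d c = c ≡ base d ⊎ c ≡ shift (dir d) (base d)

Vertical : Domino → Set
Vertical d = dir d ≡ dz

Tiling : (Cube → Set) → List Domino → Set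
Tiling R t =
  (∀ d → d ∈ t → R (base d) × R (shift (dir d) (base d)))
  × (∀ c → R c → Any (λ d → Covers d c) t)
  × (∀ (i j : Fin (length t)) → i ≢ j → ∀ c →
       Covers (lookup t i) c → Covers (lookup t j) c → ⊥)

-- Image of a domino under (x,y,z) ↦ (x,y,-z).
reflectZ : Domino → Domino
reflectZ (dom (x , y , z) dz) = dom (x , y , (- z) - + 2) dz
reflectZ (dom (x , y , z) dx) = dom (x , y , (- z) - + 1) dx
reflectZ (dom (x , y , z) dy) = dom (x , y , (- z) - + 1) dy

EvenTiling : List Domino → Set
EvenTiling t = ∀ d → d ∈ t → reflectZ d ∈ t

-- s ⊆ plug_j(t)  iff  s × [j-1,j+1] is a domino of t.
InPlug : ℤ → List Domino → Square → Set
InPlug j t (a , b) = dom (a , b , j - + 1) dz ∈ t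

-- Flips in a 2×2×1 box with base cube b, spanned by two directions.
data Plane : Set where
  pxy pxz pyz : Plane

d₁ d₂ : Plane → Dir
d₁ pxy = dx
d₁ pxz = dx
d₁ pyz = dy
d₂ pxy = dy
d₂ pxz = dz
d₂ pyz = dz

boxA boxB : Plane → Cube → List Domino
boxA π b = dom b (d₁ π) ∷ dom (shift (d₂ π) b) (d₁ π) ∷ []
boxB π b = dom b (d₂ π) ∷ dom (shift (d₁ π) b) (d₂ π) ∷ []

Flip : List Domino → List Domino → Set
Flip t t' = Σ Plane λ π → Σ Cube λ b → Σ (List Domino) λ rest →
  (t ↭ boxA π b ++ rest × t' ↭ boxB π b ++ rest)
  ⊎ (t ↭ boxB π b ++ rest × t' ↭ boxA π b ++ rest)

-- Tilings are lists taken up to reordering; ≈ is the reflexive-transitive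
-- closure of flips (and reorderings of the list representation).
_≈_ : List Domino → List Domino → Set
_≈_ = Star (λ t t' → t ↭ t' ⊎ Flip t t')

-- Write N = 2k and induct on k, peeling off the outer layer z ∈ {-N, -N+1, N-2, N-1} of the cork.
-- While the plug q is nonempty, the balance of q and the connectedness of the disk give a black and a
-- white plug square joined by a simple path s₀ s₁ … s₂ₘ₊₁ in the disk avoiding the other plug squares.
-- The layer is tiled by the horizontal dominoes s₁s₂, s₃s₄, … at level -N and s₀s₁, s₂s₃, … at level
-- -N+1, by a vertical domino at the bottom of each remaining column, and by the mirror images of all
-- these at the top; s₀ and s₂ₘ₊₁ leave the plug and the inner cork of half-height N-2 is tiled
-- recursively.  The resulting tiling t is even and no vertical domino of t crosses level 0.
--
-- Flipping a horizontal domino with the two vertical dominoes above it moves it two levels up, so each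
-- bottom horizontal domino sweeps up its two columns until it meets its mirror image, and the pair
-- becomes vertical: t is flip-equivalent to the tiling of the cork by vertical columns.  Flips do not
-- change how often a cube is covered, hence t is a tiling, and the vertical tiling is the only one,
-- since every vertical domino rests on the one below it.

module Submission where

open import Defs

open import Data.Empty using (⊥; ⊥-elim)
open import Data.Fin using (zero; suc)
import Data.Fin.Properties as Fin
open import Data.Integer as ℤ using (ℤ; +_; -_; -[1+_])
import Data.Integer.Properties as ℤ
open import Algebra.Properties.AbelianGroup ℤ.+-0-abelianGroup
  using () renaming (∙-cancelˡ to +-cancelˡ; ∙-cancelʳ to +-cancelʳ)
open import Data.Integer.Tactic.RingSolver using (solve-∀)
open import Data.List using (List; []; _∷_; _++_; [_]; length; map; concatMap; filter; lookup)
open import Data.List.Membership.Propositional using (_∈_; _∉_; find)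
open import Data.List.Membership.Propositional.Properties
  using (∈-concatMap⁺; ∈-concatMap⁻; ∈-filter⁺; ∈-filter⁻; ∈-++⁺ˡ; ∈-++⁺ʳ; ∈-++⁻; ∈-∃++)
open import Data.List.Membership.Propositional.Properties.WithK using (unique∧set⇒bag)
open import Data.List.Properties using (++-assoc; concatMap-++; map-++; filter-accept; filter-reject)
open import Data.List.Relation.Binary.BagAndSetEquality using (∼bag⇒↭)
import Data.List.Relation.Binary.Permutation.Propositional as ↭
open import Data.List.Relation.Binary.Permutation.Propositional
  using (_↭_; ↭-refl; ↭-sym; ↭-trans; ↭-reflexive; prep; swap; module PermutationReasoning)
open import Data.List.Relation.Binary.Permutation.Propositional.Properties
  using (++⁺ˡ; ++⁺ʳ; ++⁺; shifts; ∷↭∷ʳ; map⁺; ∈-resp-↭; filter-↭; ↭-length)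
  renaming (shift to ↭-shift)
import Data.List.Relation.Binary.Permutation.Setoid.Properties as ↭ₛ
open import Data.List.Relation.Binary.Subset.Propositional using (_⊆_)
open import Data.List.Relation.Unary.All as All using (All; []; _∷_)
import Data.List.Relation.Unary.All.Properties as All
import Data.List.Relation.Unary.Any as Any
open import Data.List.Relation.Unary.Any using (Any; here; there; index)
open import Data.List.Relation.Unary.Any.Properties using (lookup-index)
open import Data.List.Relation.Unary.Unique.Propositional using (Unique; []; _∷_)
import Data.List.Relation.Unary.Unique.Propositional.Properties as Unique
open import Data.Nat as ℕ using (ℕ; zero; suc; _≤_; _<_; _*_; _%_; z≤n; s≤s)
open import Data.Nat.ListAction using (sum)
open import Data.Nat.ListAction.Properties using (sum-++; sum-↭)
import Data.Nat.Properties as ℕ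
open import Data.Nat.Tactic.RingSolver using () renaming (solve-∀ to ℕ-solve-∀)
open import Data.Product using (Σ; _×_; _,_; proj₁; proj₂; ∃)
open import Data.Product.Properties using (≡-dec)
open import Data.List.Membership.DecPropositional (≡-dec ℤ._≟_ ℤ._≟_) using (_∈?_)
open import Data.Sum as Sum using (_⊎_; inj₁; inj₂)
open import Function using (_∘_; id)
open import Function.Bundles using (mk⇔)
open import Relation.Binary.Construct.Closure.ReflexiveTransitive
  using (Star; ε; _◅_; _◅◅_; gmap; reverse)
open import Relation.Binary.PropositionalEquality
  using (_≡_; _≢_; refl; sym; trans; cong; cong₂; subst; subst₂; setoid; module ≡-Reasoning)
open import Relation.Nullary using (¬_; ¬?; Dec; yes; no)
import Relation.Unary as U

concatMap-↭ : ∀ {A B : Set} (f : A → List B) {xs ys} → xs ↭ ys → concatMap f xs ↭ concatMap f ys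
concatMap-↭ f ↭.refl         = ↭-refl
concatMap-↭ f (↭.prep x p)   = ++⁺ˡ (f x) (concatMap-↭ f p)
concatMap-↭ f (↭.swap x y p) = ↭-trans (shifts (f x) (f y)) (++⁺ˡ (f y) (++⁺ˡ (f x) (concatMap-↭ f p)))
concatMap-↭ f (↭.trans p q)  = ↭-trans (concatMap-↭ f p) (concatMap-↭ f q)

++-interchange : ∀ {A : Set} (a b c d : List A) → (a ++ b) ++ (c ++ d) ↭ (a ++ c) ++ (b ++ d)
++-interchange a b c d = begin
  (a ++ b) ++ (c ++ d)  ≡⟨ ++-assoc a b (c ++ d) ⟩
  a ++ (b ++ (c ++ d))  ↭⟨ ++⁺ˡ a (shifts b c) ⟩
  a ++ (c ++ (b ++ d))  ≡⟨ ++-assoc a c (b ++ d) ⟨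
  (a ++ c) ++ (b ++ d)  ∎
  where open PermutationReasoning

Unique-resp-↭ : ∀ {A : Set} {xs ys : List A} → xs ↭ ys → Unique xs → Unique ys
Unique-resp-↭ {A} p = ↭ₛ.Unique-resp-↭ (setoid A) (↭.↭⇒↭ₛ p)

extract : ∀ {A : Set} {x : A} {xs} → x ∈ xs → ∃ λ ys → xs ↭ x ∷ ys
extract x∈xs with ∈-∃++ x∈xs
... | ys , zs , refl = ys ++ zs , ↭-shift _ ys zs

extract-pair : ∀ {A : Set} {x y : A} {xs} → x ∈ xs → y ∈ xs → x ≢ y → ∃ λ ys → xs ↭ x ∷ y ∷ ys
extract-pair x∈xs y∈xs x≢y with extract x∈xs
... | ys , xs↭ with ∈-resp-↭ xs↭ y∈xs
...   | here y≡x   = ⊥-elim (x≢y (sym y≡x))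
...   | there y∈ys = let zs , ys↭ = extract y∈ys in zs , ↭-trans xs↭ (prep _ ys↭)

↭⇒≈ : ∀ {t t'} → t ↭ t' → t ≈ t'
↭⇒≈ p = inj₁ p ◅ ε

Flip-sym : ∀ {t t'} → Flip t t' → Flip t' t
Flip-sym (π , b , r , inj₁ (p , q)) = π , b , r , inj₂ (q , p)
Flip-sym (π , b , r , inj₂ (p , q)) = π , b , r , inj₁ (q , p)

≈-sym : ∀ {t t'} → t ≈ t' → t' ≈ t
≈-sym = reverse (Sum.map ↭-sym Flip-sym)

module _ (F G : List Domino → List Domino)
         (F-resp : ∀ {u v} → u ↭ v → F u ↭ F v)
         (F-box : ∀ box r → F (box ++ r) ↭ box ++ G r) where

  Flip-context : ∀ {t t'} → Flip t t' → Flip (F t) (F t')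
  Flip-context {t} {t'} (π , b , r , f) = π , b , G r , Sum.map push push f
    where
    push : ∀ {X Y : List Domino} → t ↭ X ++ r × t' ↭ Y ++ r → F t ↭ X ++ G r × F t' ↭ Y ++ G r
    push (p , q) = ↭-trans (F-resp p) (F-box _ r) , ↭-trans (F-resp q) (F-box _ r)

  ≈-context : ∀ {t t'} → t ≈ t' → F t ≈ F t'
  ≈-context = gmap F (Sum.map F-resp Flip-context)

≈-++ˡ : ∀ (zs : List Domino) {t t'} → t ≈ t' → (zs ++ t) ≈ (zs ++ t')
≈-++ˡ zs = ≈-context (zs ++_) (zs ++_) (++⁺ˡ zs) (λ box r → shifts zs box)

≈-++ʳ : ∀ (zs : List Domino) {t t'} → t ≈ t' → (t ++ zs) ≈ (t' ++ zs)
≈-++ʳ zs = ≈-context (_++ zs) (_++ zs) (++⁺ʳ zs) (λ box r → ↭-reflexive (++-assoc box r zs))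

≈-++ : ∀ {t t' u u'} → t ≈ t' → u ≈ u' → (t ++ u) ≈ (t' ++ u')
≈-++ p q = ≈-++ʳ _ p ◅◅ ≈-++ˡ _ q

module ≈-Reasoning where

  infix  1 begin_
  infixr 2 _≈⟨_⟩_ _↭⟨_⟩_ _≡⟨_⟩_
  infix  3 _∎

  begin_ : ∀ {t t'} → t ≈ t' → t ≈ t'
  begin p = p

  _≈⟨_⟩_ : ∀ t {u v} → t ≈ u → u ≈ v → t ≈ v
  _ ≈⟨ p ⟩ q = p ◅◅ q

  _↭⟨_⟩_ : ∀ t {u v} → t ↭ u → u ≈ v → t ≈ v
  _ ↭⟨ p ⟩ q = ↭⇒≈ p ◅◅ q

  _≡⟨_⟩_ : ∀ t {u v} → t ≡ u → u ≈ v → t ≈ v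
  _ ≡⟨ refl ⟩ q = q

  _∎ : ∀ t → t ≈ t
  _ ∎ = ε

up : ℤ → ℤ
up z = z ℤ.+ + 1

-- Tail recursion makes up (up z) ↑ k and z ↑ suc (suc k) definitionally equal.
_↑_ : ℤ → ℕ → ℤ
z ↑ zero  = z
z ↑ suc k = up z ↑ k

double : ℕ → ℕ
double zero    = zero
double (suc n) = suc (suc (double n))

double-+ : ∀ n → double n ≡ n ℕ.+ n
double-+ zero    = refl
double-+ (suc n) = cong suc (trans (cong suc (double-+ n)) (sym (ℕ.+-suc n n)))

double-* : ∀ k → double k ≡ 2 * k
double-* k = trans (double-+ k) (cong (k ℕ.+_) (sym (ℕ.+-identityʳ k)))

↑-suc : ∀ z k → z ↑ suc k ≡ up (z ↑ k)
↑-suc z zero    = refl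
↑-suc z (suc k) = ↑-suc (up z) k

↑-+ : ∀ z k → z ↑ k ≡ z ℤ.+ + k
↑-+ z zero    = sym (ℤ.+-identityʳ z)
↑-+ z (suc k) = trans (↑-+ (up z) k) (trans (assoc z (+ k)) (cong (λ x → z ℤ.+ x) (sym (ℤ.pos-+ 1 k))))
  where
  assoc : ∀ x y → x ℤ.+ + 1 ℤ.+ y ≡ x ℤ.+ (+ 1 ℤ.+ y)
  assoc = solve-∀

↑-injective : ∀ z {k m} → z ↑ k ≡ z ↑ m → k ≡ m
↑-injective z {k} {m} eq = ℤ.+-injective (+-cancelˡ z (+ k) (+ m) (trans (sym (↑-+ z k)) (trans eq (↑-+ z m))))

↑-mono-≤ : ∀ z {k m} → k ≤ m → z ↑ k ℤ.≤ z ↑ m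
↑-mono-≤ z {k} {m} k≤m = subst₂ ℤ._≤_ (sym (↑-+ z k)) (sym (↑-+ z m)) (ℤ.+-monoʳ-≤ z (ℤ.+≤+ k≤m))

↑-mono-< : ∀ z {k m} → k < m → z ↑ k ℤ.< z ↑ m
↑-mono-< z {k} {m} k<m = subst₂ ℤ._<_ (sym (↑-+ z k)) (sym (↑-+ z m)) (ℤ.+-monoʳ-< z (ℤ.+<+ k<m))

↑-cancel-< : ∀ z {k m} → z ↑ k ℤ.< z ↑ m → k < m
↑-cancel-< z lt = ℕ.≰⇒> (λ m≤k → ℤ.<⇒≱ lt (↑-mono-≤ z m≤k))

≤⇒↑ : ∀ {a z} → a ℤ.≤ z → ∃ λ k → z ≡ a ↑ k
≤⇒↑ {a} {z} a≤z = ℤ.∣ z ℤ.- a ∣ , (begin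
  z                          ≡⟨ split a z ⟩
  a ℤ.+ (z ℤ.- a)            ≡⟨ cong (λ x → a ℤ.+ x) (ℤ.0≤i⇒+∣i∣≡i (ℤ.i≤j⇒0≤j-i a≤z)) ⟨
  a ℤ.+ + ℤ.∣ z ℤ.- a ∣      ≡⟨ ↑-+ a _ ⟨
  a ↑ ℤ.∣ z ℤ.- a ∣          ∎)
  where
  open ≡-Reasoning
  split : ∀ a z → z ≡ a ℤ.+ (z ℤ.- a)
  split = solve-∀

≢-up : ∀ z → z ≢ up z
≢-up z = ℕ.0≢1+n ∘ ↑-injective z {0} {1}

up-neg : ∀ h → up (- + suc h) ≡ - + h
up-neg zero    = refl
up-neg (suc h) = refl

centred-top : ∀ h → (- + h) ↑ double h ≡ + h
centred-top h = begin
  (- + h) ↑ double h       ≡⟨ ↑-+ (- + h) (double h) ⟩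
  - + h ℤ.+ + double h     ≡⟨ cong (λ k → - + h ℤ.+ + k) (double-+ h) ⟩
  - + h ℤ.+ + (h ℕ.+ h)    ≡⟨ cong (λ x → - + h ℤ.+ x) (ℤ.pos-+ h h) ⟩
  - + h ℤ.+ (+ h ℤ.+ + h)  ≡⟨ cancel (+ h) ⟩
  + h                      ∎
  where
  open ≡-Reasoning
  cancel : ∀ x → - x ℤ.+ (x ℤ.+ x) ≡ x
  cancel = solve-∀

centred-levels⁻ : ∀ {h z} → - + h ℤ.≤ z → z ℤ.< + h → ∃ λ k → k < double h × z ≡ (- + h) ↑ k
centred-levels⁻ {h} lo hi with ≤⇒↑ lo
... | k , refl = k , ↑-cancel-< (- + h) (subst ((- + h) ↑ k ℤ.<_) (sym (centred-top h)) hi) , refl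

centred-levels⁺ : ∀ {h k} → k < double h → - + h ℤ.≤ (- + h) ↑ k × (- + h) ↑ k ℤ.< + h
centred-levels⁺ {h} {k} k<2h =
  ↑-mono-≤ (- + h) {0} {k} z≤n ,
  subst ((- + h) ↑ k ℤ.<_) (centred-top h) (↑-mono-< (- + h) k<2h)

cube : Square → ℤ → Cube
cube σ z = proj₁ σ , proj₂ σ , z

cube-level : ∀ {σ σ' z z'} → cube σ z ≡ cube σ' z' → z ≡ z'
cube-level = cong (proj₂ ∘ proj₂)

cube-square : ∀ {σ σ' z z'} → cube σ z ≡ cube σ' z' → σ ≡ σ'
cube-square = cong (λ c → proj₁ c , proj₁ (proj₂ c))

vert : Square → ℤ → Domino
vert σ z = dom (cube σ z) dz

data Step : Set where
  east west north south : Step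

move : Step → Square → Square
move east  σ = proj₁ σ ℤ.+ + 1 , proj₂ σ
move west  σ = proj₁ σ ℤ.- + 1 , proj₂ σ
move north σ = proj₁ σ , proj₂ σ ℤ.+ + 1
move south σ = proj₁ σ , proj₂ σ ℤ.- + 1

Edge : Set
Edge = Square × Step

src tgt : Edge → Square
src (σ , _) = σ
tgt (σ , st) = move st σ

horiz : Edge → ℤ → Domino
horiz (σ , east)  z = dom (cube σ z) dx
horiz (σ , west)  z = dom (cube (move west σ) z) dx
horiz (σ , north) z = dom (cube σ z) dy
horiz (σ , south) z = dom (cube (move south σ) z) dy

reflectZ-horiz : ∀ e z → reflectZ (horiz e z) ≡ horiz e (- z ℤ.- + 1)
reflectZ-horiz (σ , east)  z = refl
reflectZ-horiz (σ , west)  z = refl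
reflectZ-horiz (σ , north) z = refl
reflectZ-horiz (σ , south) z = refl

east-west : ∀ σ → move east (move west σ) ≡ σ
east-west (x , y) = cong (_, y) (cancel x)
  where
  cancel : ∀ x → x ℤ.- + 1 ℤ.+ + 1 ≡ x
  cancel = solve-∀

north-south : ∀ σ → move north (move south σ) ≡ σ
north-south (x , y) = cong (x ,_) (cancel y)
  where
  cancel : ∀ y → y ℤ.- + 1 ℤ.+ + 1 ≡ y
  cancel = solve-∀

flip-box : ∀ π b r → (boxA π b ++ r) ≈ (boxB π b ++ r)
flip-box π b r = inj₂ (π , b , r , inj₁ (↭-refl , ↭-refl)) ◅ ε

horiz-flip : ∀ e z r →
  (horiz e z ∷ horiz e (up z) ∷ r) ≈ (vert (src e) z ∷ vert (tgt e) z ∷ r)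
horiz-flip (σ , east)  z r = flip-box pxz (cube σ z) r
horiz-flip (σ , north) z r = flip-box pyz (cube σ z) r
horiz-flip (σ , west)  z r = horiz-flip (move west σ , east) z r ◅◅ ↭⇒≈ (↭-trans
  (↭-reflexive (cong (λ s → vert (move west σ) z ∷ vert s z ∷ r) (east-west σ))) (swap _ _ ↭-refl))
horiz-flip (σ , south) z r = horiz-flip (move south σ , north) z r ◅◅ ↭⇒≈ (↭-trans
  (↭-reflexive (cong (λ s → vert (move south σ) z ∷ vert s z ∷ r) (north-south σ))) (swap _ _ ↭-refl))

horiz-lift : ∀ e z r →
  (horiz e z ∷ vert (src e) (up z) ∷ vert (tgt e) (up z) ∷ r)
  ≈ (vert (src e) z ∷ vert (tgt e) z ∷ horiz e (up (up z)) ∷ r)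
horiz-lift e z r =
  ≈-++ˡ [ horiz e z ] (≈-sym (horiz-flip e (up z) r)) ◅◅ horiz-flip e z (horiz e (up (up z)) ∷ r)

-- Sweeping horizontal dominoes through columns

stack : Square → ℤ → ℕ → List Domino
stack σ z zero    = []
stack σ z (suc h) = vert σ z ∷ stack σ (up (up z)) h

stack₂ : Edge → ℤ → ℕ → List Domino
stack₂ e z zero    = []
stack₂ e z (suc h) = vert (src e) z ∷ vert (tgt e) z ∷ stack₂ e (up (up z)) h

stack-snoc : ∀ σ z h → stack σ z (suc h) ≡ stack σ z h ++ [ vert σ (z ↑ double h) ]
stack-snoc σ z zero    = refl
stack-snoc σ z (suc h) = cong (vert σ z ∷_) (stack-snoc σ (up (up z)) h)

stack₂-split : ∀ e z h → stack₂ e z h ↭ stack (src e) z h ++ stack (tgt e) z h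
stack₂-split e z zero    = ↭-refl
stack₂-split e z (suc h) = prep _ (↭-trans (prep _ (stack₂-split e (up (up z)) h))
  (↭-sym (↭-shift (vert (tgt e) z) (stack (src e) (up (up z)) h) (stack (tgt e) (up (up z)) h))))

sweep : ∀ e z h →
  (horiz e z ∷ stack₂ e (up z) h ++ [ horiz e (up z ↑ double h) ]) ≈ stack₂ e z (suc h)
sweep e z zero    = horiz-flip e z []
sweep e z (suc h) =
  horiz-lift e z _ ◅◅ ≈-++ˡ (vert (src e) z ∷ vert (tgt e) z ∷ []) (sweep e (up (up z)) h)

column : Square → ℕ → List Domino
column σ h = stack σ (- + h) h

mirror : Domino → List Domino
mirror d = d ∷ reflectZ d ∷ []

mirrored : List Domino → List Domino
mirrored = concatMap mirror

column-peel : ∀ σ h → column σ (suc (suc h)) ↭ mirror (vert σ (- + suc (suc h))) ++ column σ h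
column-peel σ h = prep _ (begin
  stack σ (up (- + suc h)) (suc h)            ≡⟨ cong (λ z → stack σ z (suc h)) (up-neg h) ⟩
  stack σ (- + h) (suc h)                     ≡⟨ stack-snoc σ (- + h) h ⟩
  column σ h ++ [ vert σ ((- + h) ↑ double h) ] ≡⟨ cong (λ z → column σ h ++ [ vert σ z ]) (centred-top h) ⟩
  column σ h ++ [ vert σ (+ h) ]              ↭⟨ ∷↭∷ʳ _ _ ⟨
  vert σ (+ h) ∷ column σ h                   ∎)
  where open PermutationReasoning

capped-sweep : ∀ e h →
  (mirror (horiz e (- + suc h)) ++ column (src e) h ++ column (tgt e) h)
  ≈ (column (src e) (suc h) ++ column (tgt e) (suc h))
capped-sweep e h = begin
  horiz e a ∷ reflectZ (horiz e a) ∷ (column (src e) h ++ column (tgt e) h)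
    ≡⟨ cong (λ d → horiz e a ∷ d ∷ (column (src e) h ++ column (tgt e) h)) (reflectZ-horiz e a) ⟩
  horiz e a ∷ horiz e (+ h) ∷ (column (src e) h ++ column (tgt e) h)
    ↭⟨ prep _ (↭-trans (prep _ (↭-sym (stack₂-split e (- + h) h))) (∷↭∷ʳ _ _)) ⟩
  horiz e a ∷ (stack₂ e (- + h) h ++ [ horiz e (+ h) ])
    ≡⟨ cong (λ z → horiz e a ∷ (stack₂ e (- + h) h ++ [ horiz e z ])) (sym (centred-top h)) ⟩
  horiz e a ∷ (stack₂ e (- + h) h ++ [ horiz e ((- + h) ↑ double h) ])
    ≡⟨ cong (λ z → horiz e a ∷ (stack₂ e z h ++ [ horiz e (z ↑ double h) ])) (sym (up-neg h)) ⟩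
  horiz e a ∷ (stack₂ e (up a) h ++ [ horiz e (up a ↑ double h) ])
    ≈⟨ sweep e a h ⟩
  stack₂ e a (suc h)
    ↭⟨ stack₂-split e a (suc h) ⟩
  column (src e) (suc h) ++ column (tgt e) (suc h) ∎
  where
  open ≈-Reasoning
  a = - + suc h

endpoints : List Edge → List Square
endpoints = concatMap (λ e → src e ∷ tgt e ∷ [])

columns : List Square → (Square → ℕ) → List Domino
columns S H = concatMap (λ σ → column σ (H σ)) S

caps : List Edge → ℕ → List Domino
caps L h = map (λ e → horiz e (- + suc h)) L

sweep-edges : ∀ L h →
  (mirrored (caps L h) ++ columns (endpoints L) (λ _ → h)) ≈ columns (endpoints L) (λ _ → suc h)
sweep-edges []      h = ε
sweep-edges (e ∷ L) h = begin
  mirror (horiz e (- + suc h)) ++ M ++ (cs ++ ct ++ C)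
    ↭⟨ ++⁺ˡ (mirror _) (↭-trans (↭-reflexive (cong (M ++_) (sym (++-assoc cs ct C))))
                                 (shifts M (cs ++ ct))) ⟩
  (mirror (horiz e (- + suc h)) ++ cs ++ ct) ++ M ++ C
    ≈⟨ ≈-++ (capped-sweep e h) (sweep-edges L h) ⟩
  (column (src e) (suc h) ++ column (tgt e) (suc h)) ++ columns (endpoints L) (λ _ → suc h)
    ≡⟨ ++-assoc (column (src e) (suc h)) _ _ ⟩
  columns (endpoints (e ∷ L)) (λ _ → suc h) ∎
  where
  open ≈-Reasoning
  M  = mirrored (caps L h)
  cs = column (src e) h
  ct = column (tgt e) h
  C  = columns (endpoints L) (λ _ → h)

path-strip : ∀ {b w} outer inner → endpoints outer ↭ b ∷ w ∷ endpoints inner → ∀ n →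
  (mirrored (caps inner (suc n) ++ caps outer n) ++ columns (endpoints outer) (λ _ → n))
  ≈ (column b (suc n) ++ column w (suc n) ++ columns (endpoints inner) (λ _ → suc (suc n)))
path-strip {b} {w} outer inner split n = begin
  mirrored (caps inner (suc n) ++ caps outer n) ++ X
    ≡⟨ cong (_++ X) (concatMap-++ mirror (caps inner (suc n)) (caps outer n)) ⟩
  (mI ++ mirrored (caps outer n)) ++ X
    ≡⟨ ++-assoc mI _ X ⟩
  mI ++ mirrored (caps outer n) ++ X
    ≈⟨ ≈-++ˡ mI (sweep-edges outer n) ⟩
  mI ++ columns (endpoints outer) (λ _ → suc n)
    ↭⟨ ++⁺ˡ mI (concatMap-↭ (λ σ → column σ (suc n)) split) ⟩
  mI ++ cb ++ cw ++ Y
    ≡⟨ cong (mI ++_) (sym (++-assoc cb cw Y)) ⟩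
  mI ++ (cb ++ cw) ++ Y
    ↭⟨ shifts mI (cb ++ cw) ⟩
  (cb ++ cw) ++ mI ++ Y
    ≈⟨ ≈-++ˡ (cb ++ cw) (sweep-edges inner (suc n)) ⟩
  (cb ++ cw) ++ columns (endpoints inner) (λ _ → suc (suc n))
    ≡⟨ ++-assoc cb cw _ ⟩
  cb ++ cw ++ columns (endpoints inner) (λ _ → suc (suc n)) ∎
  where
  open ≈-Reasoning
  X  = columns (endpoints outer) (λ _ → n)
  Y  = columns (endpoints inner) (λ _ → suc n)
  mI = mirrored (caps inner (suc n))
  cb = column b (suc n)
  cw = column w (suc n)

-- Exact covers

_≟ᶜ_ : (c c' : Cube) → Dec (c ≡ c')
_≟ᶜ_ = ≡-dec ℤ._≟_ (≡-dec ℤ._≟_ ℤ._≟_)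

indicator : ∀ {P : Set} → Dec P → ℕ
indicator (yes _) = 1
indicator (no _)  = 0

-- A sum of indicators (not a disjunction): a flip then merely permutes the four summands of its box.
hits : Domino → Cube → ℕ
hits d c = indicator (c ≟ᶜ base d) ℕ.+ indicator (c ≟ᶜ shift (dir d) (base d))

count : List Domino → Cube → ℕ
count t c = sum (map (λ d → hits d c) t)

count-++ : ∀ t u c → count (t ++ u) c ≡ count t c ℕ.+ count u c
count-++ t u c = trans (cong sum (map-++ (λ d → hits d c) t u)) (sum-++ (map (λ d → hits d c) t) _)

count-↭ : ∀ {t u} → t ↭ u → ∀ c → count t c ≡ count u c
count-↭ p c = sum-↭ (map⁺ (λ d → hits d c) p)

+-interchange : ∀ a b c d → a ℕ.+ b ℕ.+ (c ℕ.+ d ℕ.+ 0) ≡ a ℕ.+ c ℕ.+ (b ℕ.+ d ℕ.+ 0)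
+-interchange = ℕ-solve-∀

count-box : ∀ π b c → count (boxA π b) c ≡ count (boxB π b) c
count-box π (x , y , z) c = box π
  where
  b = x , y , z
  at : Cube → ℕ
  at c' = indicator (c ≟ᶜ c')
  box : ∀ π → count (boxA π b) c ≡ count (boxB π b) c
  box pxy = +-interchange (at b) (at (shift dx b)) (at (shift dy b)) (at (shift dx (shift dy b)))
  box pxz = +-interchange (at b) (at (shift dx b)) (at (shift dz b)) (at (shift dx (shift dz b)))
  box pyz = +-interchange (at b) (at (shift dy b)) (at (shift dz b)) (at (shift dy (shift dz b)))

count-Flip : ∀ {t t'} → Flip t t' → ∀ c → count t c ≡ count t' c
count-Flip {t} {t'} (π , b , r , f) c =
  Sum.[ (λ (p , q) → via p q (count-box π b c)) , (λ (p , q) → via p q (sym (count-box π b c))) ] f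
  where
  via : ∀ {X Y} → t ↭ X ++ r → t' ↭ Y ++ r → count X c ≡ count Y c → count t c ≡ count t' c
  via {X} {Y} p q eq = begin
    count t c           ≡⟨ count-↭ p c ⟩
    count (X ++ r) c    ≡⟨ count-++ X r c ⟩
    count X c ℕ.+ count r c ≡⟨ cong (ℕ._+ count r c) eq ⟩
    count Y c ℕ.+ count r c ≡⟨ count-++ Y r c ⟨
    count (Y ++ r) c    ≡⟨ count-↭ q c ⟨
    count t' c          ∎
    where open ≡-Reasoning

count-≈ : ∀ {t t'} → t ≈ t' → ∀ c → count t c ≡ count t' c
count-≈ ε                c = refl
count-≈ (inj₁ p ◅ steps) c = trans (count-↭ p c) (count-≈ steps c)
count-≈ (inj₂ f ◅ steps) c = trans (count-Flip f c) (count-≈ steps c)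

record ExactCover (R : Cube → Set) (t : List Domino) : Set where
  field
    covered-once : ∀ {c} → R c → count t c ≡ 1
    occupied     : ∀ {c} → 1 ≤ count t c → R c
open ExactCover

ExactCover-≈ : ∀ {R t t'} → t ≈ t' → ExactCover R t' → ExactCover R t
ExactCover-≈ t≈t' cover = record
  { covered-once = λ {c} r → trans (count-≈ t≈t' c) (covered-once cover r)
  ; occupied     = λ {c} n → occupied cover (subst (1 ≤_) (count-≈ t≈t' c) n)
  }

ExactCover-resp : ∀ {R R' t} → R U.≐ R' → ExactCover R t → ExactCover R' t
ExactCover-resp (R⊆R' , R'⊆R) cover = record
  { covered-once = covered-once cover ∘ R'⊆R
  ; occupied     = R⊆R' ∘ occupied cover
  }

base≢top : ∀ d → base d ≢ shift (dir d) (base d)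
base≢top (dom (x , y , z) dx) eq = ≢-up x (cong proj₁ eq)
base≢top (dom (x , y , z) dy) eq = ≢-up y (cong (proj₁ ∘ proj₂) eq)
base≢top (dom (x , y , z) dz) eq = ≢-up z (cong (proj₂ ∘ proj₂) eq)

hits-covered : ∀ d {c} → Covers d c → hits d c ≡ 1
hits-covered d {c} covers with c ≟ᶜ base d | c ≟ᶜ shift (dir d) (base d)
... | yes p | yes q = ⊥-elim (base≢top d (trans (sym p) q))
... | yes _ | no _  = refl
... | no _  | yes _ = refl
... | no ¬p | no ¬q = ⊥-elim (Sum.[ ¬p , ¬q ] covers)

hits⇒covers : ∀ d {c} → 1 ≤ hits d c → Covers d c
hits⇒covers d {c} h with c ≟ᶜ base d | c ≟ᶜ shift (dir d) (base d)
... | yes p | _     = inj₁ p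
... | no _  | yes q = inj₂ q
... | no _  | no _  = ⊥-elim (ℕ.n≮0 h)

covers⇒hits : ∀ d {c} → Covers d c → 1 ≤ hits d c
covers⇒hits d covers = ℕ.≤-reflexive (sym (hits-covered d covers))

hits≤count : ∀ {d t} c → d ∈ t → hits d c ≤ count t c
hits≤count c (here refl) = ℕ.m≤m+n _ _
hits≤count {t = d' ∷ _} c (there d∈t) = ℕ.≤-trans (hits≤count c d∈t) (ℕ.m≤n+m _ (hits d' c))

lookup-hits≤count : ∀ t i c → hits (lookup t i) c ≤ count t c
lookup-hits≤count (d ∷ t) zero    c = ℕ.m≤m+n _ _
lookup-hits≤count (d ∷ t) (suc i) c = ℕ.≤-trans (lookup-hits≤count t i c) (ℕ.m≤n+m _ (hits d c))

count⇒covered : ∀ t c → 1 ≤ count t c → Any (λ d → Covers d c) t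
count⇒covered (d ∷ t) c h with hits d c in eq
... | zero  = there (count⇒covered t c h)
... | suc _ = here (hits⇒covers d (ℕ.≤-trans (s≤s z≤n) (ℕ.≤-reflexive (sym eq))))

two-hits : ∀ t {i j} c → i ≢ j → 1 ≤ hits (lookup t i) c → 1 ≤ hits (lookup t j) c → 2 ≤ count t c
two-hits (d ∷ t) {zero}  {zero}  c i≢j _  _  = ⊥-elim (i≢j refl)
two-hits (d ∷ t) {zero}  {suc j} c _   hi hj = ℕ.+-mono-≤ hi (ℕ.≤-trans hj (lookup-hits≤count t j c))
two-hits (d ∷ t) {suc i} {zero}  c _   hi hj =
  subst (2 ≤_) (ℕ.+-comm _ (hits d c)) (ℕ.+-mono-≤ (ℕ.≤-trans hi (lookup-hits≤count t i c)) hj)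
two-hits (d ∷ t) {suc i} {suc j} c i≢j hi hj =
  ℕ.≤-trans (two-hits t c (i≢j ∘ cong suc) hi hj) (ℕ.m≤n+m _ (hits d c))

uncovered : ∀ {R t c} → ExactCover R t → ¬ R c → count t c ≡ 0
uncovered cover ¬r = ℕ.n<1⇒n≡0 (ℕ.≰⇒> (¬r ∘ occupied cover))

ExactCover⇒Tiling : ∀ {R t} → ExactCover R t → Tiling R t
ExactCover⇒Tiling {R} {t} cover = inside , covered , disjoint
  where
  in-region : ∀ {d c} → d ∈ t → Covers d c → R c
  in-region {d} {c} d∈t covers = occupied cover (ℕ.≤-trans (covers⇒hits d covers) (hits≤count c d∈t))

  inside : ∀ d → d ∈ t → R (base d) × R (shift (dir d) (base d))
  inside d d∈t = in-region d∈t (inj₁ refl) , in-region d∈t (inj₂ refl)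

  covered : ∀ c → R c → Any (λ d → Covers d c) t
  covered c r = count⇒covered t c (ℕ.≤-reflexive (sym (covered-once cover r)))

  disjoint : ∀ i j → i ≢ j → ∀ c → Covers (lookup t i) c → Covers (lookup t j) c → ⊥
  disjoint i j i≢j c ci cj = ℕ.<-irrefl (sym once) twice
    where
    twice = two-hits t c i≢j (covers⇒hits _ ci) (covers⇒hits _ cj)
    once  = covered-once cover {c} (occupied cover (ℕ.≤-trans (s≤s z≤n) twice))

ExactCover-single : ∀ d → ExactCover (Covers d) [ d ]
ExactCover-single d = record
  { covered-once = λ covers → trans (ℕ.+-identityʳ _) (hits-covered d covers)
  ; occupied     = λ h → hits⇒covers d (subst (1 ≤_) (ℕ.+-identityʳ _) h)
  }

ExactCover-++ : ∀ {R R' t t'} → ExactCover R t → ExactCover R' t' → (∀ {c} → R c → R' c → ⊥) →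
  ExactCover (R U.∪ R') (t ++ t')
ExactCover-++ {R} {R'} {t} {t'} cover cover' disjoint = record { covered-once = once ; occupied = occ }
  where
  once : ∀ {c} → R c ⊎ R' c → count (t ++ t') c ≡ 1
  once {c} (inj₁ r)  = trans (count-++ t t' c)
    (cong₂ ℕ._+_ (covered-once cover r) (uncovered cover' (disjoint r)))
  once {c} (inj₂ r') = trans (count-++ t t' c)
    (cong₂ ℕ._+_ (uncovered cover (λ r → disjoint r r')) (covered-once cover' r'))

  occ : ∀ {c} → 1 ≤ count (t ++ t') c → R c ⊎ R' c
  occ {c} h with count t c | count-++ t t' c | occupied cover {c}
  ... | zero  | eq | _  = inj₂ (occupied cover' (subst (1 ≤_) eq h))
  ... | suc _ | _  | in-R = inj₁ (in-R (s≤s z≤n))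

ExactCover-concatMap : ∀ {A : Set} {R : A → Cube → Set} (f : A → List Domino) {xs} → Unique xs →
  (∀ x → ExactCover (R x) (f x)) → (∀ {x y c} → R x c → R y c → x ≡ y) →
  ExactCover (λ c → Any (λ x → R x c) xs) (concatMap f xs)
ExactCover-concatMap f {[]} _ _ _ = record { covered-once = λ () ; occupied = λ () }
ExactCover-concatMap {R = R} f {x ∷ xs} (x∉xs ∷ unique) cover same =
  ExactCover-resp (Sum.[ here , there ] , any-split)
    (ExactCover-++ (cover x) (ExactCover-concatMap f unique cover same) disjoint)
  where
  disjoint : ∀ {c} → R x c → Any (λ y → R y c) xs → ⊥
  disjoint r rs with find rs
  ... | y , y∈xs , r' = All.lookup x∉xs y∈xs (same r r')

  any-split : ∀ {c} → Any (λ y → R y c) (x ∷ xs) → R x c ⊎ Any (λ y → R y c) xs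
  any-split (here r)   = inj₁ r
  any-split (there rs) = inj₂ rs

Tiling⇒Unique : ∀ {R t} → Tiling R t → Unique t
Tiling⇒Unique {t = t} (_ , _ , disjoint) = distinct-entries t (λ i j i≢j eq →
  disjoint i j i≢j _ (inj₁ refl) (subst (λ d → Covers d _) eq (inj₁ refl)))
  where
  distinct-entries : ∀ t → (∀ i j → i ≢ j → lookup t i ≢ lookup t j) → Unique t
  distinct-entries []      _        = []
  distinct-entries (d ∷ t) distinct =
    All.tabulate (λ d'∈t eq → distinct zero (suc (index d'∈t)) (λ ()) (trans eq (lookup-index d'∈t))) ∷
    distinct-entries t (λ i j i≢j → distinct (suc i) (suc j) (i≢j ∘ Fin.suc-injective))

Tiling⇒covers-unique : ∀ {R t d d' c} → Tiling R t → d ∈ t → d' ∈ t →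
  Covers d c → Covers d' c → d ≡ d'
Tiling⇒covers-unique {t = t} {c = c} (_ , _ , disjoint) d∈t d'∈t covers covers'
  with index d∈t Fin.≟ index d'∈t
... | yes same = trans (lookup-index d∈t) (trans (cong (lookup t) same) (sym (lookup-index d'∈t)))
... | no  i≢j  = ⊥-elim (disjoint _ _ i≢j c
  (subst (λ d → Covers d c) (lookup-index d∈t) covers) (subst (λ d → Covers d c) (lookup-index d'∈t) covers'))

tilings-↭ : ∀ {R t t'} → Tiling R t → Tiling R t' → (∀ {d} → d ∈ t → d ∈ t') → t ↭ t'
tilings-↭ {t = t} {t'} tiling tiling'@(inside' , _ , _) t⊆t' =
  ∼bag⇒↭ (unique∧set⇒bag (Tiling⇒Unique tiling) (Tiling⇒Unique tiling') (mk⇔ t⊆t' t'⊆t))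
  where
  t'⊆t : ∀ {d} → d ∈ t' → d ∈ t
  t'⊆t {d} d∈t' with find (proj₁ (proj₂ tiling) (base d) (proj₁ (inside' d d∈t')))
  ... | d'' , d''∈t , covers = subst (_∈ t)
    (Tiling⇒covers-unique tiling' (t⊆t' d''∈t) d∈t' covers (inj₁ refl)) d''∈t

-- The tiling by vertical dominoes

InStack : Square → ℤ → ℕ → Cube → Set
InStack σ a h c = ∃ λ k → k < double h × c ≡ cube σ (a ↑ k)

stack-exact : ∀ σ a h → ExactCover (InStack σ a h) (stack σ a h)
stack-exact σ a zero    = record { covered-once = λ { (_ , () , _) } ; occupied = λ () }
stack-exact σ a (suc h) = ExactCover-resp (merge , split)
  (ExactCover-++ (ExactCover-single (vert σ a)) (stack-exact σ (up (up a)) h) disjoint)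
  where
  split : InStack σ a (suc h) U.⊆ (Covers (vert σ a) U.∪ InStack σ (up (up a)) h)
  split (zero , _ , eq)                       = inj₁ (inj₁ eq)
  split (suc zero , _ , eq)                   = inj₁ (inj₂ eq)
  split (suc (suc k) , s≤s (s≤s k<2h) , eq) = inj₂ (k , k<2h , eq)

  merge : (Covers (vert σ a) U.∪ InStack σ (up (up a)) h) U.⊆ InStack σ a (suc h)
  merge (inj₁ (inj₁ eq))       = 0 , s≤s z≤n , eq
  merge (inj₁ (inj₂ eq))       = 1 , s≤s (s≤s z≤n) , eq
  merge (inj₂ (k , k<2h , eq)) = suc (suc k) , s≤s (s≤s k<2h) , eq

  disjoint : ∀ {c} → Covers (vert σ a) c → InStack σ (up (up a)) h c → ⊥
  disjoint (inj₁ eq) (k , _ , eq') with ↑-injective a {0} {suc (suc k)} (cube-level (trans (sym eq) eq'))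
  ... | ()
  disjoint (inj₂ eq) (k , _ , eq') with ↑-injective a {1} {suc (suc k)} (cube-level (trans (sym eq) eq'))
  ... | ()

InColumns : List Square → (Square → ℕ) → Cube → Set
InColumns S H c = Any (λ σ → InStack σ (- + H σ) (H σ) c) S

columns-exact : ∀ {S} H → Unique S → ExactCover (InColumns S H) (columns S H)
columns-exact H unique =
  ExactCover-concatMap _ unique (λ σ → stack-exact σ (- + H σ) (H σ)) same-square
  where
  same-square : ∀ {σ σ' c} → InStack σ (- + H σ) (H σ) c → InStack σ' (- + H σ') (H σ') c → σ ≡ σ'
  same-square (_ , _ , eq) (_ , _ , eq') = cube-square (trans (sym eq) eq')

stack-∈ : ∀ σ a {i h} → i < h → vert σ (a ↑ double i) ∈ stack σ a h
stack-∈ σ a {zero}  {suc h} _            = here refl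
stack-∈ σ a {suc i} {suc h} (s≤s i<h) = there (stack-∈ σ (up (up a)) i<h)

-- Number of dominoes in the column of σ in R_{-N,N;q,q}: the column is [-N, N), or [-N+1, N-1) under q.
height : List Square → ℕ → Square → ℕ
height q N σ with σ ∈? q
... | yes _ = ℕ.pred N
... | no  _ = N

verticalTiling : List Square → List Square → ℕ → List Domino
verticalTiling D q N = columns D (height q N)

height-∈ : ∀ {q σ} N → σ ∈ q → height q N σ ≡ ℕ.pred N
height-∈ {q} {σ} N σ∈q with σ ∈? q
... | yes _   = refl
... | no  σ∉q = ⊥-elim (σ∉q σ∈q)

height-∉ : ∀ {q σ} N → σ ∉ q → height q N σ ≡ N
height-∉ {q} {σ} N σ∉q with σ ∈? q
... | yes σ∈q = ⊥-elim (σ∉q σ∈q)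
... | no  _   = refl

verticalTiling-zero : ∀ D q → verticalTiling D q 0 ≡ []
verticalTiling-zero []      q = refl
verticalTiling-zero (σ ∷ D) q with σ ∈? q
... | yes _ = verticalTiling-zero D q
... | no  _ = verticalTiling-zero D q

module _ (D q : List Square) where

  cork-level⁻ : ∀ N {σ z} → Cork D (- + N) (+ N) q q (cube σ z) →
    ∃ λ k → k < double (height q N σ) × z ≡ (- + height q N σ) ↑ k
  cork-level⁻ N {σ} (_ , lo , hi , _ , _) with σ ∈? q
  ... | no _ = centred-levels⁻ lo hi
  cork-level⁻ zero    (_ , lo , hi , _ , _) | yes _ = ⊥-elim (ℤ.<-irrefl refl (ℤ.≤-<-trans lo hi))
  cork-level⁻ (suc M) (_ , lo , hi , not-bottom , not-top) | yes σ∈q with centred-levels⁻ lo hi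
  ... | zero , _ , refl = ⊥-elim (not-bottom (σ∈q , refl))
  ... | suc k , s≤s (s≤s k≤2M) , refl =
    k , ℕ.≤∧≢⇒< k≤2M (λ { refl → not-top (σ∈q , top-level) }) , cong (_↑ k) (up-neg M)
    where
    top-level : up (- + suc M) ↑ double M ≡ + M
    top-level = trans (cong (_↑ double M) (up-neg M)) (centred-top M)

  cork-level⁺ : ∀ N {σ k} → σ ∈ D → k < double (height q N σ) →
    Cork D (- + N) (+ N) q q (cube σ ((- + height q N σ) ↑ k))
  cork-level⁺ N {σ} σ∈D k<2h with σ ∈? q
  ... | no σ∉q = let lo , hi = centred-levels⁺ k<2h in σ∈D , lo , hi , σ∉q ∘ proj₁ , σ∉q ∘ proj₁
  cork-level⁺ zero    _ () | yes _
  cork-level⁺ (suc M) {σ} {k} σ∈D k<2M | yes _ =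
    σ∈D , lo , hi ,
    (λ (_ , eq) → ℕ.1+n≢0 (↑-injective (- + suc M) {suc k} {0} (trans shifted eq))) ,
    (λ (_ , eq) → ℕ.<-irrefl (↑-injective (- + M) (trans eq (sym (centred-top M)))) k<2M)
    where
    shifted : (- + suc M) ↑ suc k ≡ (- + M) ↑ k
    shifted = cong (_↑ k) (up-neg M)
    bounds = subst (λ z → - + suc M ℤ.≤ z × z ℤ.< + suc M) shifted
                   (centred-levels⁺ (s≤s (ℕ.m≤n⇒m≤1+n k<2M)))
    lo = proj₁ bounds
    hi = proj₂ bounds

  columns≐cork : ∀ N → InColumns D (height q N) U.≐ Cork D (- + N) (+ N) q q
  columns≐cork N = in-cork , in-columns
    where
    in-cork : InColumns D (height q N) U.⊆ Cork D (- + N) (+ N) q q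
    in-cork c∈columns with find c∈columns
    ... | σ , σ∈D , k , k<2h , refl = cork-level⁺ N σ∈D k<2h

    in-columns : Cork D (- + N) (+ N) q q U.⊆ InColumns D (height q N)
    in-columns {x , y , z} cork@(σ∈D , _) = Any.map (λ { refl → let k , k<2h , eq = cork-level⁻ N cork in
      k , k<2h , cong (cube (x , y)) eq }) σ∈D

  verticalTiling-exact : ∀ N → Unique D → ExactCover (Cork D (- + N) (+ N) q q) (verticalTiling D q N)
  verticalTiling-exact N unique =
    ExactCover-resp (columns≐cork N) (columns-exact (height q N) unique)

vertical-cover : ∀ {t σ z} → All Vertical t → Any (λ d → Covers d (cube σ z)) t →
  vert σ z ∈ t ⊎ ∃ λ z' → vert σ z' ∈ t × up z' ≡ z
vertical-cover {t} {σ} {z} vertical covered with find covered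
... | dom (x , y , z') r , d∈t , covers with All.lookup vertical d∈t
...   | refl with covers
...     | inj₁ eq = inj₁ (subst (λ b → dom b dz ∈ t) (sym eq) d∈t)
...     | inj₂ eq = inj₂ (z' , subst (λ s → vert s z' ∈ t) (sym (cube-square eq)) d∈t , sym (cube-level eq))

module _ {R t} (tiling : Tiling R t) (vertical : All Vertical t) {σ a}
         (above : ∀ {z} → R (cube σ z) → ∃ λ k → z ≡ a ↑ k)
         (downward : ∀ {k} → R (cube σ (a ↑ suc k)) → R (cube σ (a ↑ k))) where

  private
    inside = proj₁ tiling
    covered = proj₁ (proj₂ tiling)

    below : ∀ k → vert σ (a ↑ suc k) ∈ t → ∃ λ z → vert σ z ∈ t × up z ≡ a ↑ k
    below k d∈t with vertical-cover vertical
                       (covered (cube σ (a ↑ k)) (downward {k} (proj₁ (inside (vert σ (a ↑ suc k)) d∈t))))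
    ... | inj₂ found = found
    ... | inj₁ d'∈t  = ⊥-elim (ℕ.1+n≢n (sym (↑-injective a {k} {suc k} (cong (proj₂ ∘ proj₂ ∘ base)
      (Tiling⇒covers-unique tiling d'∈t d∈t (inj₂ (cong (cube σ) (↑-suc a k))) (inj₁ refl))))))

  -- Each vertical domino in the column rests on another one, down to level a.
  vertical-parity : ∀ k → vert σ (a ↑ k) ∈ t → ∃ λ i → k ≡ double i
  vertical-parity zero          _   = 0 , refl
  vertical-parity (suc zero)    d∈t with below 0 d∈t
  ... | z , d'∈t , eq with above (proj₁ (inside (vert σ z) d'∈t))
  ...   | j , refl = ⊥-elim (ℕ.1+n≢0 (↑-injective a {suc j} {0} (trans (↑-suc a j) eq)))
  vertical-parity (suc (suc k)) d∈t with below (suc k) d∈t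
  ... | z , d'∈t , eq
    with vertical-parity k (subst (λ z → vert σ z ∈ t) (+-cancelʳ (+ 1) z _ (trans eq (↑-suc a k))) d'∈t)
  ...   | i , refl = suc i , refl

double-< : ∀ {i h} → suc (double i) < double h → i < h
double-< {zero}  {suc h} _                 = s≤s z≤n
double-< {suc i} {suc h} (s≤s (s≤s lt)) = s≤s (double-< lt)

vertical-tiling-↭ : ∀ {D q N tv} → Unique D → Tiling (Cork D (- + N) (+ N) q q) tv → All Vertical tv →
  tv ↭ verticalTiling D q N
vertical-tiling-↭ {D} {q} {N} {tv} unique tiling vertical =
  tilings-↭ tiling (ExactCover⇒Tiling (verticalTiling-exact D q N unique)) tv⊆columns
  where
  Region = Cork D (- + N) (+ N) q q

  module Column (σ : Square) where
    a = - + height q N σ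

    above : ∀ {z} → Region (cube σ z) → ∃ λ k → z ≡ a ↑ k
    above cork = let k , _ , eq = cork-level⁻ D q N cork in k , eq

    downward : ∀ {k} → Region (cube σ (a ↑ suc k)) → Region (cube σ (a ↑ k))
    downward {k} cork with cork-level⁻ D q N cork
    ... | k' , k'<2h , eq = cork-level⁺ D q N (proj₁ cork)
      (ℕ.<-trans (ℕ.n<1+n k) (subst (_< double (height q N σ)) (sym (↑-injective a eq)) k'<2h))

    member : ∀ {z} → vert σ z ∈ tv → vert σ z ∈ verticalTiling D q N
    member {z} d∈tv with proj₁ tiling _ d∈tv
    ... | bottom , top with cork-level⁻ D q N bottom
    ...   | k , _ , refl with vertical-parity tiling vertical above (λ {k} → downward {k}) k d∈tv
    ...     | i , refl with cork-level⁻ D q N top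
    ...       | k' , k'<2h , eq = ∈-concatMap⁺ (λ σ → column σ (height q N σ))
      (Any.map (λ { refl → stack-∈ σ a (double-< (subst (_< double (height q N σ)) step k'<2h)) }) (proj₁ bottom))
      where
      step : k' ≡ suc (double i)
      step = sym (↑-injective a (trans (↑-suc a (double i)) eq))

  tv⊆columns : ∀ {d} → d ∈ tv → d ∈ verticalTiling D q N
  tv⊆columns {dom (x , y , z) r} d∈tv with All.lookup vertical d∈tv
  ... | refl = Column.member (x , y) d∈tv

-- Even tilings

mirror-twice : ∀ k z → - (- z ℤ.- k) ℤ.- k ≡ z
mirror-twice = solve-∀

reflectZ-involutive : ∀ d → reflectZ (reflectZ d) ≡ d
reflectZ-involutive (dom (x , y , z) dx) = cong (λ z → dom (x , y , z) dx) (mirror-twice (+ 1) z)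
reflectZ-involutive (dom (x , y , z) dy) = cong (λ z → dom (x , y , z) dy) (mirror-twice (+ 1) z)
reflectZ-involutive (dom (x , y , z) dz) = cong (λ z → dom (x , y , z) dz) (mirror-twice (+ 2) z)

mirrored-even : ∀ B → EvenTiling (mirrored B)
mirrored-even B d d∈ with find (∈-concatMap⁻ mirror {B} d∈)
... | d₀ , d₀∈B , here refl         =
  ∈-concatMap⁺ mirror {B} (Any.map (λ { refl → there (here refl) }) d₀∈B)
... | d₀ , d₀∈B , there (here refl) =
  ∈-concatMap⁺ mirror {B} (Any.map (λ { refl → here (reflectZ-involutive d₀) }) d₀∈B)

central : Square → Domino
central s = vert s -[1+ 0 ]

OffCentre : Domino → Set
OffCentre d = ∀ s → d ≢ central s

mirrored-off-centre : ∀ {B} → All OffCentre B → ∀ s → ¬ InPlug (+ 0) (mirrored B) s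
mirrored-off-centre {B} off (x , y) c∈ with find (∈-concatMap⁻ mirror {B} c∈)
... | d₀ , d₀∈B , here eq         = All.lookup off d₀∈B (x , y) (sym eq)
... | d₀ , d₀∈B , there (here eq) =
  All.lookup off d₀∈B (x , y) (trans (sym (reflectZ-involutive d₀)) (cong reflectZ (sym eq)))

horiz-off-centre : ∀ e z → OffCentre (horiz e z)
horiz-off-centre (σ , east)  z s ()
horiz-off-centre (σ , west)  z s ()
horiz-off-centre (σ , north) z s ()
horiz-off-centre (σ , south) z s ()

caps-off-centre : ∀ L h → All OffCentre (caps L h)
caps-off-centre L h = All.map⁺ (All.universal (λ e → horiz-off-centre e (- + suc h)) L)

-- Peeling off the outer layer of a cork

shells : (Square → ℕ) → List Square → List Domino
shells H S = map (λ σ → vert σ (- + suc (suc (H σ)))) S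

columns-cong : ∀ S {H H'} → (∀ {σ} → σ ∈ S → H σ ≡ H' σ) → columns S H ≡ columns S H'
columns-cong []      _    = refl
columns-cong (σ ∷ S) same = cong₂ (λ h c → column σ h ++ c) (same (here refl)) (columns-cong S (same ∘ there))

columns-peel : ∀ S {H H'} → (∀ {σ} → σ ∈ S → H σ ≡ suc (suc (H' σ))) →
  columns S H ↭ mirrored (shells H' S) ++ columns S H'
columns-peel []      _       = ↭-refl
columns-peel (σ ∷ S) {H} {H'} heights = begin
  column σ (H σ) ++ columns S H
    ≡⟨ cong (λ h → column σ h ++ columns S H) (heights (here refl)) ⟩
  column σ (suc (suc (H' σ))) ++ columns S H
    ↭⟨ ++⁺ (column-peel σ (H' σ)) (columns-peel S (heights ∘ there)) ⟩
  (mirror bottom ++ column σ (H' σ)) ++ (mirrored (shells H' S) ++ columns S H')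
    ↭⟨ ++-interchange (mirror bottom) (column σ (H' σ)) (mirrored (shells H' S)) (columns S H') ⟩
  (mirror bottom ++ mirrored (shells H' S)) ++ (column σ (H' σ) ++ columns S H') ∎
  where
  open PermutationReasoning
  bottom = vert σ (- + suc (suc (H' σ)))

_∖_ : List Square → List Square → List Square
D ∖ P = filter (λ σ → ¬? (σ ∈? P)) D

↭-split : ∀ {D P} → Unique D → Unique P → P ⊆ D → D ↭ P ++ D ∖ P
↭-split {D} {P} unique-D unique-P P⊆D =
  ∼bag⇒↭ (unique∧set⇒bag unique-D (Unique.++⁺ unique-P (Unique.filter⁺ _ unique-D) disjoint)
    (mk⇔ to from))
  where
  disjoint : ∀ {σ} → σ ∈ P × σ ∈ D ∖ P → ⊥
  disjoint (σ∈P , σ∈D∖P) = proj₂ (∈-filter⁻ _ {xs = D} σ∈D∖P) σ∈P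

  to : ∀ {σ} → σ ∈ D → σ ∈ P ++ D ∖ P
  to {σ} σ∈D with σ ∈? P
  ... | yes σ∈P = ∈-++⁺ˡ σ∈P
  ... | no  σ∉P = ∈-++⁺ʳ P (∈-filter⁺ _ σ∈D σ∉P)

  from : ∀ {σ} → σ ∈ P ++ D ∖ P → σ ∈ D
  from σ∈ = Sum.[ P⊆D , proj₁ ∘ ∈-filter⁻ _ {xs = D} ] (∈-++⁻ P σ∈)

shell-step : ∀ {D P} → Unique D → Unique P → P ⊆ D →
  ∀ {H H'} → (∀ {σ} → σ ∉ P → H σ ≡ suc (suc (H' σ))) → ∀ cap →
  (mirrored cap ++ columns P H') ≈ columns P H →
  (mirrored (cap ++ shells H' (D ∖ P)) ++ columns D H') ≈ columns D H
shell-step {D} {P} unique-D unique-P P⊆D {H} {H'} heights cap strip = begin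
  mirrored (cap ++ S) ++ columns D H'
    ≡⟨ cong (_++ columns D H') (concatMap-++ mirror cap S) ⟩
  (mirrored cap ++ mirrored S) ++ columns D H'
    ↭⟨ ++⁺ˡ _ (split H') ⟩
  (mirrored cap ++ mirrored S) ++ (columns P H' ++ columns (D ∖ P) H')
    ↭⟨ ++-interchange (mirrored cap) (mirrored S) (columns P H') (columns (D ∖ P) H') ⟩
  (mirrored cap ++ columns P H') ++ (mirrored S ++ columns (D ∖ P) H')
    ≈⟨ ≈-++ strip (↭⇒≈ (↭-sym (columns-peel (D ∖ P) (heights ∘ proj₂ ∘ ∈-filter⁻ _ {xs = D})))) ⟩
  columns P H ++ columns (D ∖ P) H
    ↭⟨ ↭-sym (split H) ⟩
  columns D H ∎
  where
  open ≈-Reasoning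
  S = shells H' (D ∖ P)
  split : ∀ H → columns D H ↭ columns P H ++ columns (D ∖ P) H
  split H = ↭-trans (concatMap-↭ _ (↭-split unique-D unique-P P⊆D))
                    (↭-reflexive (concatMap-++ (λ σ → column σ (H σ)) P (D ∖ P)))

Black : Square → Set
Black s = ℤ.∣ proj₁ s ℤ.+ proj₂ s ∣ % 2 ≡ 0

record Opposite (m n : ℕ) : Set where
  field
    even⇒odd : m % 2 ≡ 0 → n % 2 ≢ 0
    odd⇒even : m % 2 ≢ 0 → n % 2 ≡ 0

opposite-suc : ∀ n → Opposite n (suc n)
opposite-suc n = record { even⇒odd = even n ; odd⇒even = odd n }
  where
  even : ∀ n → n % 2 ≡ 0 → suc n % 2 ≢ 0
  even zero          _  ()
  even (suc zero)    ()
  even (suc (suc n)) = even n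
  odd : ∀ n → n % 2 ≢ 0 → suc n % 2 ≡ 0
  odd zero          ≢0 = ⊥-elim (≢0 refl)
  odd (suc zero)    _  = refl
  odd (suc (suc n)) = odd n

opposite-sym : ∀ {m n} → Opposite m n → Opposite n m
opposite-sym {m} {n} opp = record
  { even⇒odd = λ n-even m-even → Opposite.even⇒odd opp m-even n-even
  ; odd⇒even = m-even
  }
  where
  m-even : n % 2 ≢ 0 → m % 2 ≡ 0
  m-even n-odd with m % 2 ℕ.≟ 0
  ... | yes even = even
  ... | no  odd  = ⊥-elim (n-odd (Opposite.odd⇒even opp odd))

opposite-up : ∀ i → Opposite ℤ.∣ i ∣ ℤ.∣ up i ∣
opposite-up (+ n)        = subst (Opposite n) (ℕ.+-comm 1 n) (opposite-suc n)
opposite-up -[1+ zero ]  = opposite-sym (opposite-suc 0)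
opposite-up -[1+ suc n ] = opposite-sym (opposite-suc (suc n))

opposite-next : ∀ i {j} → up i ≡ j → Opposite ℤ.∣ i ∣ ℤ.∣ j ∣
opposite-next i refl = opposite-up i

opposite-move : ∀ st s →
  Opposite ℤ.∣ proj₁ s ℤ.+ proj₂ s ∣ ℤ.∣ proj₁ (move st s) ℤ.+ proj₂ (move st s) ∣
opposite-move east  (x , y) = opposite-next (x ℤ.+ y) (rearrange x y)
  where
  rearrange : ∀ x y → x ℤ.+ y ℤ.+ + 1 ≡ x ℤ.+ + 1 ℤ.+ y
  rearrange = solve-∀
opposite-move north (x , y) = opposite-next (x ℤ.+ y) (rearrange x y)
  where
  rearrange : ∀ x y → x ℤ.+ y ℤ.+ + 1 ≡ x ℤ.+ (y ℤ.+ + 1)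
  rearrange = solve-∀
opposite-move west  (x , y) = opposite-sym (opposite-next (x ℤ.- + 1 ℤ.+ y) (rearrange x y))
  where
  rearrange : ∀ x y → x ℤ.- + 1 ℤ.+ y ℤ.+ + 1 ≡ x ℤ.+ y
  rearrange = solve-∀
opposite-move south (x , y) = opposite-sym (opposite-next (x ℤ.+ (y ℤ.- + 1)) (rearrange x y))
  where
  rearrange : ∀ x y → x ℤ.+ (y ℤ.- + 1) ℤ.+ + 1 ≡ x ℤ.+ y
  rearrange = solve-∀

black⇒move-white : ∀ {s} st → Black s → ¬ Black (move st s)
black⇒move-white {s} st = Opposite.even⇒odd (opposite-move st s)

white⇒move-black : ∀ {s} st → ¬ Black s → Black (move st s)
white⇒move-black {s} st = Opposite.odd⇒even (opposite-move st s)

filter-witness : ∀ {P : Square → Set} (P? : U.Decidable P) xs → 1 ≤ length (filter P? xs) →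
  ∃ λ x → x ∈ xs × P x
filter-witness P? xs nonempty with filter P? xs in eq
... | []    = ⊥-elim (ℕ.n≮0 nonempty)
... | x ∷ _ = x , ∈-filter⁻ P? {xs = xs} (subst (x ∈_) (sym eq) (here refl))

filter-nonempty : ∀ {P : Square → Set} (P? : U.Decidable P) {x xs} → x ∈ xs → P x →
  1 ≤ length (filter P? xs)
filter-nonempty P? x∈xs px = nonempty (∈-filter⁺ P? x∈xs px)
  where
  nonempty : ∀ {x : Square} {ys} → x ∈ ys → 1 ≤ length ys
  nonempty (here _)  = s≤s z≤n
  nonempty (there _) = s≤s z≤n

black-and-white : ∀ {q x} → Balanced q → x ∈ q →
  (∃ λ b → b ∈ q × Black b) × (∃ λ w → w ∈ q × ¬ Black w)
black-and-white {q} {x} balanced x∈q with black? x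
... | yes black = (x , x∈q , black) ,
  filter-witness (λ s → ¬? (black? s)) q (subst (1 ≤_) balanced (filter-nonempty black? x∈q black))
... | no  white =
  filter-witness black? q (subst (1 ≤_) (sym balanced) (filter-nonempty (λ s → ¬? (black? s)) x∈q white)) ,
  (x , x∈q , white)

balanced-remove : ∀ {b w q q'} → q ↭ b ∷ w ∷ q' → Black b → ¬ Black w → Balanced q → Balanced q'
balanced-remove {b} {w} {q} {q'} q↭ black white balanced = ℕ.suc-injective (begin
  suc (length (filter black? q'))        ≡⟨ cong (suc ∘ length) (filter-reject black? {w} {q'} white) ⟨
  suc (length (filter black? (w ∷ q')))  ≡⟨ cong length (filter-accept black? {b} {w ∷ q'} black) ⟨
  length (filter black? (b ∷ w ∷ q'))    ≡⟨ ↭-length (filter-↭ black? q↭) ⟨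
  length (filter black? q)               ≡⟨ balanced ⟩
  length (filter white? q)               ≡⟨ ↭-length (filter-↭ white? q↭) ⟩
  length (filter white? (b ∷ w ∷ q'))    ≡⟨ cong length (filter-reject white? {b} {w ∷ q'} (λ ¬black → ¬black black)) ⟩
  length (filter white? (w ∷ q'))        ≡⟨ cong length (filter-accept white? {w} {q'} white) ⟩
  suc (length (filter white? q'))        ∎)
  where
  open ≡-Reasoning
  white? = λ s → ¬? (black? s)

-- Paths between plug squares

+≡1 : ∀ {m n} → m ℕ.+ n ≡ 1 → (m ≡ 0 × n ≡ 1) ⊎ (m ≡ 1 × n ≡ 0)
+≡1 {zero}        eq   = inj₁ (refl , eq)
+≡1 {suc zero}    refl = inj₂ (refl , refl)
+≡1 {suc (suc _)} ()

difference⇒ : ∀ a {a' d} → a ℤ.- a' ≡ d → a' ≡ a ℤ.- d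
difference⇒ a {a'} refl = recover a a'
  where
  recover : ∀ a a' → a' ≡ a ℤ.- (a ℤ.- a')
  recover = solve-∀

same-coordinate : ∀ {a a'} → ℤ.∣ a ℤ.- a' ∣ ≡ 0 → a' ≡ a
same-coordinate {a} eq = trans (difference⇒ a (ℤ.∣i∣≡0⇒i≡0 eq)) (ℤ.+-identityʳ a)

∣i∣≡1⇒±1 : ∀ {i} → ℤ.∣ i ∣ ≡ 1 → i ≡ + 1 ⊎ i ≡ -[1+ 0 ]
∣i∣≡1⇒±1 {+ .1}       refl = inj₁ refl
∣i∣≡1⇒±1 { -[1+ .0 ]} refl = inj₂ refl

next-coordinate : ∀ {a a'} → ℤ.∣ a ℤ.- a' ∣ ≡ 1 → a' ≡ a ℤ.- + 1 ⊎ a' ≡ a ℤ.+ + 1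
next-coordinate {a} {a'} eq = Sum.map (difference⇒ a) (difference⇒ a) (∣i∣≡1⇒±1 {a ℤ.- a'} eq)

adjacent-step : ∀ s s' → Adjacent s s' → ∃ λ st → s' ≡ move st s
adjacent-step (a , b) (a' , b') adjacent with +≡1 {ℤ.∣ a ℤ.- a' ∣} adjacent
... | inj₁ (same , next) with next-coordinate {b} {b'} next
...   | inj₁ eq = south , cong₂ _,_ (same-coordinate same) eq
...   | inj₂ eq = north , cong₂ _,_ (same-coordinate same) eq
adjacent-step (a , b) (a' , b') adjacent | inj₂ (next , same) with next-coordinate {a} {a'} next
...   | inj₁ eq = west , cong₂ _,_ eq (same-coordinate same)
...   | inj₂ eq = east , cong₂ _,_ eq (same-coordinate same)

Connected : List Square → Set
Connected D = ∀ s s' → s ∈ D → s' ∈ D → Star (AdjIn (_∈ D)) s s'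

data Walk : Square → Square → Set where
  stop : ∀ {s} → Walk s s
  step : ∀ {s t} (st : Step) → Walk (move st s) t → Walk s t

squares : ∀ {s t} → Walk s t → List Square
squares {s} stop       = s ∷ []
squares {s} (step _ W) = s ∷ squares W

All-start : ∀ {P : Square → Set} {s t} (W : Walk s t) → All P (squares W) → P s
All-start stop       (p ∷ _) = p
All-start (step _ _) (p ∷ _) = p

walk : ∀ {D s t} → Star (AdjIn (_∈ D)) s t → s ∈ D → Σ (Walk s t) λ W → All (_∈ D) (squares W)
walk ε s∈D = stop , s∈D ∷ []
walk {s = s} (_◅_ {j = m} (_ , m∈D , adjacent) rest) s∈D with adjacent-step s m adjacent
... | st , refl with walk rest m∈D
... | W , W⊆D = step st W , s∈D ∷ W⊆D

PlugFree : List Square → ∀ {s t} → Walk s t → Set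
PlugFree q {s} {t} W = ∀ {x} → x ∈ squares W → x ∈ q → x ≡ s ⊎ x ≡ t

record Run (D q : List Square) (s : Square) : Set where
  field
    {end}     : Square
    path      : Walk s end
    path⊆D    : All (_∈ D) (squares path)
    plug-free : PlugFree q path
    end∈q     : end ∈ q
    end-white : ¬ Black end

BlackRun : List Square → List Square → Set
BlackRun D q = ∃ λ b → b ∈ q × Black b × Run D q b

-- Either a black plug square on W starts a run, or the first plug square after y along W is white.
scan : ∀ {D q y w} (W : Walk y w) → All (_∈ D) (squares W) → w ∈ q → ¬ Black w → BlackRun D q ⊎ Run D q y
scan stop (w∈D ∷ []) w∈q white =
  inj₂ (record { path = stop ; path⊆D = w∈D ∷ [] ; plug-free = λ { (here refl) _ → inj₁ refl }
               ; end∈q = w∈q ; end-white = white })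
scan {q = q} {y} (step st W) (y∈D ∷ W⊆D) w∈q white with scan W W⊆D w∈q white
... | inj₁ found = inj₁ found
... | inj₂ run with move st y ∈? q | black? (move st y)
...   | yes y'∈q | yes black = inj₁ (move st y , y'∈q , black , run)
...   | yes y'∈q | no  white' =
  inj₂ (record { path = step st stop ; path⊆D = y∈D ∷ All-start W W⊆D ∷ []
               ; plug-free = λ { (here refl) _ → inj₁ refl ; (there (here refl)) _ → inj₂ refl }
               ; end∈q = y'∈q ; end-white = white' })
...   | no  y'∉q | _ =
  inj₂ (record { path = step st (Run.path run) ; path⊆D = y∈D ∷ Run.path⊆D run
               ; plug-free = plug-free ; end∈q = Run.end∈q run ; end-white = Run.end-white run })
  where
  plug-free : PlugFree q (step st (Run.path run))
  plug-free (here refl)  _   = inj₁ refl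
  plug-free (there x∈W) x∈q with Run.plug-free run x∈W x∈q
  ... | inj₁ refl = ⊥-elim (y'∉q x∈q)
  ... | inj₂ eq   = inj₂ eq

suffix : ∀ {s t x} (W : Walk s t) → x ∈ squares W →
  Σ (Walk x t) λ V → squares V ⊆ squares W × (Unique (squares W) → Unique (squares V))
suffix stop        (here refl)  = stop , id , id
suffix (step st W) (here refl)  = step st W , id , id
suffix (step st W) (there x∈W) with suffix W x∈W
... | V , V⊆W , unique = V , there ∘ V⊆W , λ { (_ ∷ u) → unique u }

erase-loops : ∀ {s t} (W : Walk s t) → Σ (Walk s t) λ V → Unique (squares V) × squares V ⊆ squares W
erase-loops stop = stop , [] ∷ [] , id
erase-loops {s} (step st W) with erase-loops W
... | V , unique , V⊆W with s ∈? squares V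
...   | yes s∈V = let V' , V'⊆V , unique' = suffix V s∈V in V' , unique' unique , there ∘ V⊆W ∘ V'⊆V
...   | no  s∉V = step st V ,
  All.tabulate (λ x∈V s≡x → s∉V (subst (_∈ squares V) (sym s≡x) x∈V)) ∷ unique ,
  λ { (here eq) → here eq ; (there x∈V) → there (V⊆W x∈V) }

-- For a walk s₀ s₁ … s₂ₘ₊₁, matching pairs s₀s₁, s₂s₃, … and inner-matching pairs s₁s₂, s₃s₄, ….
mutual
  matching : ∀ {s t} → Walk s t → List Edge
  matching stop             = []
  matching {s} (step st W) = (s , st) ∷ inner-matching W

  inner-matching : ∀ {s t} → Walk s t → List Edge
  inner-matching stop       = []
  inner-matching (step _ W) = matching W

matching-squares : ∀ {s t} → Black s → ¬ Black t → (W : Walk s t) → endpoints (matching W) ≡ squares W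
matching-squares black white stop                  = ⊥-elim (white black)
matching-squares black white (step st stop)        = refl
matching-squares {s} black white (step st (step st' W)) =
  cong (λ S → s ∷ move st s ∷ S) (matching-squares (white⇒move-black st' (black⇒move-white st black)) white W)

matching-split : ∀ {s t} → Black s → ¬ Black t → (W : Walk s t) →
  endpoints (matching W) ↭ s ∷ t ∷ endpoints (inner-matching W)
matching-split black white stop                  = ⊥-elim (white black)
matching-split black white (step st stop)        = ↭-refl
matching-split {s} {t} black white (step st (step st' W)) = prep s (↭-trans
  (prep (move st s) (matching-split (white⇒move-black st' (black⇒move-white st black)) white W))
  (↭-shift t (move st s ∷ move st' (move st s) ∷ []) _))

record Pairing (D q : List Square) : Set where
  field
    {b w}        : Square
    outer inner  : List Edge
    split        : endpoints outer ↭ b ∷ w ∷ endpoints inner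
    outer-unique : Unique (endpoints outer)
    outer⊆D      : endpoints outer ⊆ D
    b∈q          : b ∈ q
    w∈q          : w ∈ q
    b-black      : Black b
    w-white      : ¬ Black w
    inner∉q      : ∀ {σ} → σ ∈ endpoints inner → σ ∉ q

pairing : ∀ {D q x} → Connected D → IsPlug D q → x ∈ q → Pairing D q
pairing {D} {q} connected (_ , q⊆D , balanced) x∈q with black-and-white balanced x∈q
... | (b₀ , b₀∈q , black₀) , (w₀ , w₀∈q , white₀)
  with walk (connected b₀ w₀ (q⊆D b₀ b₀∈q) (q⊆D w₀ w₀∈q)) (q⊆D b₀ b₀∈q)
... | W , W⊆D with Sum.[ id , (λ run → b₀ , b₀∈q , black₀ , run) ]′ (scan W W⊆D w₀∈q white₀)
... | b , b∈q , black , run with erase-loops (Run.path run)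
... | V , V-unique , V⊆path = record
  { outer        = matching V
  ; inner        = inner-matching V
  ; split        = split
  ; outer-unique = outer-unique
  ; outer⊆D      = λ σ∈ → All.lookup (Run.path⊆D run) (on-path σ∈)
  ; b∈q          = b∈q
  ; w∈q          = Run.end∈q run
  ; b-black      = black
  ; w-white      = Run.end-white run
  ; inner∉q      = inner∉q
  }
  where
  split = matching-split black (Run.end-white run) V

  outer-unique : Unique (endpoints (matching V))
  outer-unique = subst Unique (sym (matching-squares black (Run.end-white run) V)) V-unique

  on-path : endpoints (matching V) ⊆ squares (Run.path run)
  on-path {σ} σ∈ = V⊆path (subst (σ ∈_) (matching-squares black (Run.end-white run) V) σ∈)

  inner∉q : ∀ {σ} → σ ∈ endpoints (inner-matching V) → σ ∉ q
  inner∉q σ∈inner σ∈q with Unique-resp-↭ split outer-unique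
  ... | (_ ∷ b∉inner) ∷ (w∉inner ∷ _)
    with Run.plug-free run (on-path (∈-resp-↭ (↭-sym split) (there (there σ∈inner)))) σ∈q
  ...   | inj₁ refl = All.lookup b∉inner σ∈inner refl
  ...   | inj₂ refl = All.lookup w∉inner σ∈inner refl

LowerHalf : List Square → List Square → ℕ → Set
LowerHalf D q N = Σ (List Domino) λ B → (mirrored B ≈ verticalTiling D q N) × All OffCentre B

outer-layer : ∀ {D q q' n} P cap → Unique D → Unique P → P ⊆ D →
  (∀ {σ} → σ ∉ P → height q (suc (suc n)) σ ≡ suc (suc (height q' n σ))) →
  All OffCentre cap → (mirrored cap ++ columns P (height q' n)) ≈ columns P (height q (suc (suc n))) →
  LowerHalf D q' n → LowerHalf D q (suc (suc n))
outer-layer {D} {q} {q'} {n} P cap unique-D unique-P P⊆D heights cap-off strip (B , B≈ , B-off) =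
  cap ++ S ++ B , equivalence , All.++⁺ cap-off (All.++⁺ shells-off B-off)
  where
  S = shells (height q' n) (D ∖ P)

  shells-off : All OffCentre S
  shells-off = All.map⁺ (All.universal (λ σ s ()) (D ∖ P))

  equivalence : mirrored (cap ++ S ++ B) ≈ verticalTiling D q (suc (suc n))
  equivalence = begin
    mirrored (cap ++ S ++ B)                      ≡⟨ cong mirrored (sym (++-assoc cap S B)) ⟩
    mirrored ((cap ++ S) ++ B)                    ≡⟨ concatMap-++ mirror (cap ++ S) B ⟩
    mirrored (cap ++ S) ++ mirrored B             ≈⟨ ≈-++ˡ (mirrored (cap ++ S)) B≈ ⟩
    mirrored (cap ++ S) ++ verticalTiling D q' n  ≈⟨ shell-step unique-D unique-P P⊆D heights cap strip ⟩
    verticalTiling D q (suc (suc n))              ∎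
    where open ≈-Reasoning

module _ {D : List Square} (unique-D : Unique D) (connected : Connected D) where

  path-layer : ∀ {q n} → IsPlug D q → length q ≤ suc (suc n) → Pairing D q →
    (∀ {q'} → IsPlug D q' → length q' ≤ n → LowerHalf D q' n) → LowerHalf D q (suc (suc n))
  path-layer {q} {n} (unique-q , q⊆D , balanced) len pairs recurse =
    outer-layer {q = q} {q' = q'} {n = n} P cap unique-D outer-unique outer⊆D heights
      (All.++⁺ (caps-off-centre inner (suc n)) (caps-off-centre outer n)) strip (recurse plug' len')
    where
    open Pairing pairs
    P   = endpoints outer
    cap = caps inner (suc n) ++ caps outer n

    rest = extract-pair b∈q w∈q (λ { refl → w-white b-black })
    q'   = proj₁ rest
    q↭   = proj₂ rest

    unique-bwq' : Unique (b ∷ w ∷ q')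
    unique-bwq' = Unique-resp-↭ q↭ unique-q

    q'⊆q : q' ⊆ q
    q'⊆q σ∈q' = ∈-resp-↭ (↭-sym q↭) (there (there σ∈q'))

    plug' : IsPlug D q'
    plug' with unique-bwq'
    ... | _ ∷ _ ∷ unique-q' = unique-q' , (λ s → q⊆D s ∘ q'⊆q) , balanced-remove q↭ b-black w-white balanced

    len' : length q' ≤ n
    len' = ℕ.≤-pred (ℕ.≤-pred (subst (_≤ suc (suc n)) (↭-length q↭) len))

    P∉q' : ∀ {σ} → σ ∈ P → σ ∉ q'
    P∉q' σ∈P σ∈q' with ∈-resp-↭ split σ∈P | unique-bwq'
    ... | here refl               | (_ ∷ b∉q') ∷ _ = All.lookup b∉q' σ∈q' refl
    ... | there (here refl)       | _ ∷ w∉q' ∷ _   = All.lookup w∉q' σ∈q' refl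
    ... | there (there σ∈inner) | _              = inner∉q σ∈inner (q'⊆q σ∈q')

    heights : ∀ {σ} → σ ∉ P → height q (suc (suc n)) σ ≡ suc (suc (height q' n σ))
    heights {σ} σ∉P with σ ∈? q'
    ... | yes σ∈q' = trans (height-∈ (suc (suc n)) (q'⊆q σ∈q')) (cong suc (positive n σ∈q' len'))
      where
      positive : ∀ n {σ q'} → σ ∈ q' → length q' ≤ n → n ≡ suc (ℕ.pred n)
      positive zero    (here _)  ()
      positive zero    (there _) ()
      positive (suc n) _         _  = refl
    ... | no σ∉q' = height-∉ (suc (suc n)) σ∉q
      where
      σ∉q : σ ∉ q
      σ∉q σ∈q with ∈-resp-↭ q↭ σ∈q
      ... | here refl         = σ∉P (∈-resp-↭ (↭-sym split) (here refl))
      ... | there (here refl) = σ∉P (∈-resp-↭ (↭-sym split) (there (here refl)))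
      ... | there (there σ∈) = σ∉q' σ∈

    strip : (mirrored cap ++ columns P (height q' n)) ≈ columns P (height q (suc (suc n)))
    strip = begin
      mirrored cap ++ columns P (height q' n)
        ≡⟨ cong (mirrored cap ++_) (columns-cong P (λ σ∈P → height-∉ n (P∉q' σ∈P))) ⟩
      mirrored cap ++ columns P (λ _ → n)
        ≈⟨ path-strip outer inner split n ⟩
      column b (suc n) ++ column w (suc n) ++ columns (endpoints inner) (λ _ → suc (suc n))
        ≡⟨ cong₂ _++_ (cong (column b) (sym (height-∈ (suc (suc n)) b∈q)))
             (cong₂ _++_ (cong (column w) (sym (height-∈ (suc (suc n)) w∈q)))
               (columns-cong (endpoints inner) (λ σ∈ → sym (height-∉ (suc (suc n)) (inner∉q σ∈))))) ⟩
      columns (b ∷ w ∷ endpoints inner) (height q (suc (suc n)))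
        ↭⟨ concatMap-↭ _ (↭-sym split) ⟩
      columns P (height q (suc (suc n))) ∎
      where open ≈-Reasoning

  lower-half : ∀ k {q} → IsPlug D q → length q ≤ double k → LowerHalf D q (double k)
  lower-half zero    {[]}    _    _   = [] , ↭⇒≈ (↭-reflexive (sym (verticalTiling-zero D []))) , []
  lower-half (suc k) {[]}    plug _   =
    outer-layer {q = []} {q' = []} {n = double k} [] [] unique-D [] (λ ()) (λ _ → refl) [] ε
      (lower-half k plug z≤n)
  lower-half (suc k) {x ∷ q} plug len =
    path-layer plug len (pairing connected plug (here refl)) (λ plug' len' → lower-half k plug' len')

lemma4p3 : (D : List Square) → IsQuadDisk D → Balanced D →
    (p : List Square) → IsPlug D p →
    (N : ℕ) → Σ ℕ (λ k → N ≡ 2 * k) → 1 ≤ N → length p ≤ N →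
    Σ (List Domino) λ t →
      Tiling (Cork D (- (+ N)) (+ N) p p) t
      × EvenTiling t
      × (∀ s → ¬ InPlug (+ 0) t s)
      × (∀ tvert → Tiling (Cork D (- (+ N)) (+ N) p p) tvert → All Vertical tvert → t ≈ tvert)
lemma4p3 D (unique-D , _ , connected , _) _ p plug N (k , refl) _ |p|≤N
  with subst (LowerHalf D p) (double-* k)
         (lower-half unique-D connected k plug (subst (length p ≤_) (sym (double-* k)) |p|≤N))
... | B , B≈vertical , off-centre =
  mirrored B ,
  ExactCover⇒Tiling (ExactCover-≈ B≈vertical (verticalTiling-exact D p N unique-D)) ,
  mirrored-even B ,
  mirrored-off-centre off-centre ,
  λ tvert tiling vertical → B≈vertical ◅◅ ↭⇒≈ (↭-sym (vertical-tiling-↭ unique-D tiling vertical))
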